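{- Let $x,y$ be distinct odd primes, and let $z$ be an odd positive integer divisible by $y$ and coprime to $x$. If $x$ is not balanced modulo $z$, then $x$ is not balanced modulo $yz$.
   Context: For coprime positive integers $n,m$, "$n$ is balanced modulo $m$" is the notion of Pomerance and Ulmer; it is characterized as follows (Pomerance–Ulmer, Theorem 2.1): $n$ is NOT balanced modulo $m$ if and only if there exists an odd Dirichlet character $\chi$ modulo $m$ (i.e. $\chi(-1)=-1$) with $\chi(n)=1$ and $\sum_{0<k<m/2}\chi(k)\neq0$. -}

module Defs where

open import Data.Nat using (ℕ; zero; suc; _*_; _^_; _<ᵇ_; _≡ᵇ_)
open import Data.Nat.DivMod using (_%_)
open import Data.Bool using (Bool; _∧_)
open import Data.List using (List; upTo; filterᵇ; length)
open import Data.Bool.ListAction using (any)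
open import Data.Nat.Coprimality using (Coprime)
open import Relation.Binary.PropositionalEquality using (_≡_)

-- Boolean congruence test: b ≡ c (mod m).  (m = 0 never arises below:
-- all ranges `upTo m` are then empty.)
modEqᵇ : ℕ → ℕ → ℕ → Bool
modEqᵇ zero    b c = b ≡ᵇ c
modEqᵇ (suc m) b c = (b % suc m) ≡ᵇ (c % suc m)

-- For gcd(n,m)=1 the powers n^k mod m are
-- purely periodic with period ord_m(n) ≤ φ(m) ≤ m, so k < m suffices.
inCosetᵇ : ℕ → ℕ → ℕ → ℕ → Bool
inCosetᵇ n m a b = any (λ k → modEqᵇ m b (a * n ^ k)) (upTo m)

lowCount : ℕ → ℕ → ℕ → ℕ
lowCount n m a =
  length (filterᵇ (λ b → inCosetᵇ n m a b ∧ (0 <ᵇ b) ∧ ((2 * b) <ᵇ m)) (upTo m))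

highCount : ℕ → ℕ → ℕ → ℕ
highCount n m a =
  length (filterᵇ (λ b → inCosetᵇ n m a b ∧ (m <ᵇ (2 * b))) (upTo m))

-- Pomerance–Ulmer: n is balanced modulo m if every coset of the subgroup
-- ⟨n⟩ ≤ (ℤ/mℤ)^× has equally many elements in (0, m/2) and in (m/2, m).
Balanced : ℕ → ℕ → Set
Balanced n m = ∀ a → Coprime a m → lowCount n m a ≡ highCount n m a

module Submission where

-- Write y = 2t + 1 and M = yz, and let Q ⊆ [0, M) be the residues whose reduction mod z lies in
-- the coset a⟨x⟩ of (ℤ/z)^×.  Cut [0, M) into the blocks [jz, (j+1)z): those with j < t lie below
-- M/2, those with j > t above it, and the middle block is cut by M/2 exactly as [0, z) is cut by
-- z/2.  Hence Q has as many elements below M/2 as above it iff a⟨x⟩ is balanced modulo z.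
-- On the other hand Q is a union of cosets of ⟨x⟩ ≤ (ℤ/M)^×: as y ∣ z, z² ≡ 0 (mod M), so the
-- kernel {1 + jz : j < y} of reduction mod z is cyclic of prime order y, generated by 1 + z.
-- If 1 + z ∈ ⟨x⟩ then Q = a⟨x⟩, otherwise Q is the disjoint union of the y cosets a(1 + jz)⟨x⟩;
-- either way, x balanced modulo M makes Q balanced.

open import Data.Nat as ℕ using (ℕ; NonZero)
open import Data.Nat.Divisibility using (_∣_)
open import Data.Nat.Primality using (Prime)
open import Data.Nat.Coprimality using (Coprime)
open import Relation.Binary.PropositionalEquality using (_≡_)

module Congruence where

  open import Data.Nat as ℕ using (ℕ; zero; suc; NonZero)
  import Data.Nat.Properties as ℕP
  open import Data.Nat.DivMod using (_%_; [m+kn]%n≡m%n)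
  open import Data.Nat.Coprimality using (Coprime; coprime-Bézout)
  open import Data.Nat.GCD using (module Bézout)
  open import Data.Nat.Divisibility using (_∣_; divides)
  open import Data.Integer using (ℤ; +_; -[1+_]; _+_; _*_; -_; _-_; 1ℤ; 0ℤ; _^_; ∣_∣; _%ℕ_; _/ℕ_)
  import Data.Integer.Properties as ℤP
  open import Data.Integer.DivMod using (a≡a%ℕn+[a/ℕn]*n)
  open import Data.Integer.Tactic.RingSolver using (solve-∀)
  open import Data.Product using (Σ; _,_)
  open import Level using (0ℓ)
  open import Relation.Binary.Bundles using (Setoid)
  open import Relation.Binary.PropositionalEquality
  import Relation.Binary.Reasoning.Setoid as SetoidReasoning

  infix 4 _≈[_]_
  record _≈[_]_ (a : ℤ) (m : ℕ) (b : ℤ) : Set where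
    constructor _,_
    field
      quotient : ℤ
      equation : a ≡ b + quotient * + m

  ≈-refl : ∀ {m a} → a ≈[ m ] a
  ≈-refl {m} {a} = 0ℤ , ring a (+ m)
    where ring : ∀ a m → a ≡ a + 0ℤ * m
          ring = solve-∀

  ≈-sym : ∀ {m a b} → a ≈[ m ] b → b ≈[ m ] a
  ≈-sym {m} {b = b} (q , refl) = - q , ring b q (+ m)
    where ring : ∀ b q m → b ≡ (b + q * m) + (- q) * m
          ring = solve-∀

  ≈-trans : ∀ {m a b c} → a ≈[ m ] b → b ≈[ m ] c → a ≈[ m ] c
  ≈-trans {m} {c = c} (q , refl) (r , refl) = r + q , ring c q r (+ m)
    where ring : ∀ c q r m → (c + r * m) + q * m ≡ c + (r + q) * m
          ring = solve-∀

  ≡⇒≈ : ∀ {m a b} → a ≡ b → a ≈[ m ] b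
  ≡⇒≈ refl = ≈-refl

  ≈-setoid : ℕ → Setoid 0ℓ 0ℓ
  ≈-setoid m = record
    { Carrier       = ℤ
    ; _≈_           = λ a b → a ≈[ m ] b
    ; isEquivalence = record { refl = ≈-refl ; sym = ≈-sym ; trans = ≈-trans }
    }

  module ≈-Reasoning (m : ℕ) = SetoidReasoning (≈-setoid m)

  +-cong : ∀ {m a b c d} → a ≈[ m ] b → c ≈[ m ] d → a + c ≈[ m ] b + d
  +-cong {m} {b = b} {d = d} (q , refl) (r , refl) = q + r , ring b d q r (+ m)
    where ring : ∀ b d q r m → (b + q * m) + (d + r * m) ≡ b + d + (q + r) * m
          ring = solve-∀

  *-congˡ : ∀ {m a b} c → a ≈[ m ] b → c * a ≈[ m ] c * b
  *-congˡ {m} {b = b} c (q , refl) = c * q , ring b c q (+ m)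
    where ring : ∀ b c q m → c * (b + q * m) ≡ c * b + (c * q) * m
          ring = solve-∀

  *-congʳ : ∀ {m a b} c → a ≈[ m ] b → a * c ≈[ m ] b * c
  *-congʳ {m} {a} {b} c a≈b =
    subst₂ (λ u v → u ≈[ m ] v) (ℤP.*-comm c a) (ℤP.*-comm c b) (*-congˡ c a≈b)

  *-cong : ∀ {m a b c d} → a ≈[ m ] b → c ≈[ m ] d → a * c ≈[ m ] b * d
  *-cong {b = b} {c = c} a≈b c≈d = ≈-trans (*-congʳ c a≈b) (*-congˡ b c≈d)

  ^-cong : ∀ {m a b} n → a ≈[ m ] b → a ^ n ≈[ m ] b ^ n
  ^-cong zero    a≈b = ≈-refl
  ^-cong (suc n) a≈b = *-cong a≈b (^-cong n a≈b)

  x^k*x^pk≈1 : ∀ {m x p} k → x ^ suc p ≈[ m ] 1ℤ → x ^ k * x ^ (p ℕ.* k) ≈[ m ] 1ℤ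
  x^k*x^pk≈1 {m} {x} {p} k x^[1+p]≈1 = begin
    x ^ k * x ^ (p ℕ.* k)   ≡⟨ ℤP.^-distribˡ-+-* x k (p ℕ.* k) ⟨
    x ^ (suc p ℕ.* k)       ≡⟨ ℤP.^-*-assoc x (suc p) k ⟨
    (x ^ suc p) ^ k         ≈⟨ ^-cong k x^[1+p]≈1 ⟩
    1ℤ ^ k                  ≡⟨ ℤP.^-zeroˡ k ⟩
    1ℤ                      ∎
    where open ≈-Reasoning m

  a+km≈a : ∀ {m} a k → a + k * + m ≈[ m ] a
  a+km≈a a k = k , refl

  ≈-∣ : ∀ {m n a b} → m ∣ n → a ≈[ n ] b → a ≈[ m ] b
  ≈-∣ {m} {n} {a} {b} (divides w refl) (q , refl) = q * + w , cong (_+_ b) (begin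
    q * + (w ℕ.* m)   ≡⟨ cong (q *_) (ℤP.pos-* w m) ⟩
    q * (+ w * + m)   ≡⟨ ℤP.*-assoc q (+ w) (+ m) ⟨
    q * + w * + m     ∎)
    where open ≡-Reasoning

  a≈a%ℕm : ∀ a m .{{_ : NonZero m}} → a ≈[ m ] + (a %ℕ m)
  a≈a%ℕm a m = a /ℕ m , a≡a%ℕn+[a/ℕn]*n a m

  %≡⇒≈ : ∀ m b c .{{_ : NonZero m}} → b % m ≡ c % m → + b ≈[ m ] + c
  %≡⇒≈ m b c b%m≡c%m = begin
    + b         ≈⟨ a≈a%ℕm (+ b) m ⟩
    + (b % m)   ≡⟨ cong +_ b%m≡c%m ⟩
    + (c % m)   ≈⟨ a≈a%ℕm (+ c) m ⟨
    + c         ∎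
    where open ≈-Reasoning m

  ≡+km⇒%≡ : ∀ m b c k .{{_ : NonZero m}} → + b ≡ + c + + k * + m → b % m ≡ c % m
  ≡+km⇒%≡ m b c k eq = begin
    b % m                ≡⟨ cong (_% m) (ℤP.+-injective (begin
      + b                    ≡⟨ eq ⟩
      + c + + k * + m        ≡⟨ cong (_+_ (+ c)) (ℤP.pos-* k m) ⟨
      + c + + (k ℕ.* m)      ≡⟨ ℤP.pos-+ c (k ℕ.* m) ⟨
      + (c ℕ.+ k ℕ.* m)      ∎)) ⟩
    (c ℕ.+ k ℕ.* m) % m  ≡⟨ [m+kn]%n≡m%n c k m ⟩
    c % m                ∎
    where open ≡-Reasoning

  ≈⇒%≡ : ∀ m b c .{{_ : NonZero m}} → + b ≈[ m ] + c → b % m ≡ c % m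
  ≈⇒%≡ m b c (+ k , eq)      = ≡+km⇒%≡ m b c k eq
  ≈⇒%≡ m b c (-[1+ k ] , eq) = sym (≡+km⇒%≡ m c b (suc k) (negate (+ b) (+ c) (+ suc k) (+ m) eq))
    where
    negate : ∀ b c q n → b ≡ c + (- q) * n → c ≡ b + q * n
    negate _ c q n refl = ring c q n
      where ring : ∀ c q m → c ≡ (c + (- q) * m) + q * m
            ring = solve-∀

  Invertible : ℤ → ℕ → Set
  Invertible u m = Σ ℤ λ s → s * u ≈[ m ] 1ℤ

  coprime⇒invertible : ∀ {u m} → Coprime u m → Invertible (+ u) m
  coprime⇒invertible {u} {m} u⊥m with coprime-Bézout u⊥m
  ... | Bézout.+- s t 1+tm≡su = + s , (+ t , (begin
    + s * + u          ≡⟨ ℤP.pos-* s u ⟨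
    + (s ℕ.* u)        ≡⟨ cong +_ 1+tm≡su ⟨
    + (1 ℕ.+ t ℕ.* m)  ≡⟨ ℤP.pos-+ 1 (t ℕ.* m) ⟩
    1ℤ + + (t ℕ.* m)   ≡⟨ cong (_+_ 1ℤ) (ℤP.pos-* t m) ⟩
    1ℤ + + t * + m     ∎))
    where open ≡-Reasoning
  ... | Bézout.-+ s t 1+su≡tm = - + s , (- + t , (begin
    - + s * + u               ≡⟨ ring₁ (+ s) (+ u) ⟩
    1ℤ - (1ℤ + + s * + u)     ≡⟨ cong (λ v → 1ℤ - (1ℤ + v)) (ℤP.pos-* s u) ⟨
    1ℤ - (1ℤ + + (s ℕ.* u))   ≡⟨ cong (_-_ 1ℤ) (ℤP.pos-+ 1 (s ℕ.* u)) ⟨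
    1ℤ - + (1 ℕ.+ s ℕ.* u)    ≡⟨ cong (λ v → 1ℤ - + v) 1+su≡tm ⟩
    1ℤ - + (t ℕ.* m)          ≡⟨ cong (_-_ 1ℤ) (ℤP.pos-* t m) ⟩
    1ℤ - + t * + m            ≡⟨ ring₂ (+ t) (+ m) ⟩
    1ℤ + - + t * + m          ∎))
    where
    open ≡-Reasoning
    ring₁ : ∀ s u → - s * u ≡ 1ℤ - (1ℤ + s * u)
    ring₁ = solve-∀
    ring₂ : ∀ t m → 1ℤ - t * m ≡ 1ℤ + - t * m
    ring₂ = solve-∀

  invertible⇒coprime : ∀ {u m} → Invertible (+ u) m → Coprime u m
  invertible⇒coprime {m = m} (s , (q , su≡1+qm)) {d} (divides α refl , divides β refl) =
    ℕP.m*n≡1⇒n≡1 ∣ t ∣ d (begin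
      ∣ t ∣ ℕ.* d   ≡⟨ ℤP.abs-* t (+ d) ⟨
      ∣ t * + d ∣   ≡⟨ cong ∣_∣ 1≡td ⟨
      1             ∎)
    where
    open ≡-Reasoning
    t : ℤ
    t = s * + α - q * + β
    sα≡1+qβ : s * (+ α * + d) ≡ 1ℤ + q * (+ β * + d)
    sα≡1+qβ = begin
      s * (+ α * + d)        ≡⟨ cong (s *_) (ℤP.pos-* α d) ⟨
      s * + (α ℕ.* d)        ≡⟨ su≡1+qm ⟩
      1ℤ + q * + (β ℕ.* d)   ≡⟨ cong (λ v → 1ℤ + q * v) (ℤP.pos-* β d) ⟩
      1ℤ + q * (+ β * + d)   ∎
    ring₁ : ∀ q v → 1ℤ ≡ 1ℤ + q * v - q * v
    ring₁ = solve-∀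
    ring₂ : ∀ s q a b d → s * (a * d) - q * (b * d) ≡ (s * a - q * b) * d
    ring₂ = solve-∀
    1≡td : 1ℤ ≡ t * + d
    1≡td = begin
      1ℤ                                       ≡⟨ ring₁ q (+ β * + d) ⟩
      1ℤ + q * (+ β * + d) - q * (+ β * + d)   ≡⟨ cong (_- q * (+ β * + d)) sα≡1+qβ ⟨
      s * (+ α * + d) - q * (+ β * + d)        ≡⟨ ring₂ s q (+ α) (+ β) (+ d) ⟩
      t * + d                                  ∎

  *-invertible : ∀ {m u v} → Invertible u m → Invertible v m → Invertible (u * v) m
  *-invertible {m} {u} {v} (s , su≈1) (t , tv≈1) = s * t , (begin
    s * t * (u * v)   ≡⟨ ring s t u v ⟩
    s * u * (t * v)   ≈⟨ *-cong su≈1 tv≈1 ⟩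
    1ℤ * 1ℤ           ≡⟨⟩
    1ℤ                ∎)
    where
    open ≈-Reasoning m
    ring : ∀ s t u v → s * t * (u * v) ≡ s * u * (t * v)
    ring = solve-∀

  ^-invertible : ∀ {m u} k → Invertible u m → Invertible (u ^ k) m
  ^-invertible zero    _   = 1ℤ , ≈-refl
  ^-invertible (suc k) inv = *-invertible inv (^-invertible k inv)

  invertible-∣ : ∀ {m n u} → m ∣ n → Invertible u n → Invertible u m
  invertible-∣ m∣n (s , su≈1) = s , ≈-∣ m∣n su≈1

  invertible-square : ∀ {m u} → Invertible u m → Invertible u (m ℕ.* m)
  invertible-square {m} {u} (s , (q , su≡1+qm)) = s * (1ℤ - q * + m) , (- (q * q) , (begin
    s * (1ℤ - q * + m) * u              ≡⟨ ring₁ s u (1ℤ - q * + m) ⟩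
    s * u * (1ℤ - q * + m)              ≡⟨ cong (_* (1ℤ - q * + m)) su≡1+qm ⟩
    (1ℤ + q * + m) * (1ℤ - q * + m)     ≡⟨ ring₂ q (+ m) ⟩
    1ℤ + - (q * q) * (+ m * + m)        ≡⟨ cong (λ v → 1ℤ + - (q * q) * v) (ℤP.pos-* m m) ⟨
    1ℤ + - (q * q) * + (m ℕ.* m)        ∎))
    where
    open ≡-Reasoning
    ring₁ : ∀ s u v → s * v * u ≡ s * u * v
    ring₁ = solve-∀
    ring₂ : ∀ q m → (1ℤ + q * m) * (1ℤ - q * m) ≡ 1ℤ + - (q * q) * (m * m)
    ring₂ = solve-∀

  *-cancelˡ-≈ : ∀ {m u a b} → Invertible u m → u * a ≈[ m ] u * b → a ≈[ m ] b
  *-cancelˡ-≈ {m} {u} {a} {b} (s , su≈1) ua≈ub = begin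
    a             ≡⟨ ℤP.*-identityˡ a ⟨
    1ℤ * a        ≈⟨ *-congʳ a su≈1 ⟨
    s * u * a     ≡⟨ ℤP.*-assoc s u a ⟩
    s * (u * a)   ≈⟨ *-congˡ s ua≈ub ⟩
    s * (u * b)   ≡⟨ ℤP.*-assoc s u b ⟨
    s * u * b     ≈⟨ *-congʳ b su≈1 ⟩
    1ℤ * b        ≡⟨ ℤP.*-identityˡ b ⟩
    b             ∎
    where open ≈-Reasoning m

  1≈0⇒m≡1 : ∀ {m} → 1ℤ ≈[ m ] 0ℤ → m ≡ 1
  1≈0⇒m≡1 {m} (q , 1≡0+qm) = ℕP.m*n≡1⇒n≡1 ∣ q ∣ m (begin
    ∣ q ∣ ℕ.* m        ≡⟨ ℤP.abs-* q (+ m) ⟨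
    ∣ q * + m ∣        ≡⟨ cong ∣_∣ (ℤP.+-identityˡ (q * + m)) ⟨
    ∣ 0ℤ + q * + m ∣   ≡⟨ cong ∣_∣ 1≡0+qm ⟨
    1                  ∎)
    where open ≡-Reasoning

  invertible≈0⇒m≡1 : ∀ {m u} → Invertible u m → u ≈[ m ] 0ℤ → m ≡ 1
  invertible≈0⇒m≡1 {m} {u} (s , su≈1) u≈0 = 1≈0⇒m≡1 (begin
    1ℤ       ≈⟨ su≈1 ⟨
    s * u    ≈⟨ *-congˡ s u≈0 ⟩
    s * 0ℤ   ≡⟨ ℤP.*-zeroʳ s ⟩
    0ℤ       ∎)
    where open ≈-Reasoning m

  q≈u*[q*s%m] : ∀ {m u s} q .{{_ : NonZero m}} → s * u ≈[ m ] 1ℤ → q ≈[ m ] u * + ((q * s) %ℕ m)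
  q≈u*[q*s%m] {m} {u} {s} q su≈1 = begin
    q                  ≡⟨ ℤP.*-identityʳ q ⟨
    q * 1ℤ             ≈⟨ *-congˡ q su≈1 ⟨
    q * (s * u)        ≡⟨ ring q s u ⟩
    u * (q * s)        ≈⟨ *-congˡ u (a≈a%ℕm (q * s) m) ⟩
    u * + ((q * s) %ℕ m) ∎
    where
    open ≈-Reasoning m
    ring : ∀ q s u → q * (s * u) ≡ u * (q * s)
    ring = solve-∀

module Sums where

  open import Data.Nat using (ℕ; zero; suc; _+_; _*_; _<_; z<s; s<s)
  import Data.Nat.Properties as ℕP
  open import Algebra.Properties.CommutativeSemigroup ℕP.+-commutativeSemigroup using (interchange)
  open import Data.Bool using (Bool; true; false; T; _∧_)
  open import Data.List using (applyUpTo; filterᵇ; length)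
  open import Function using (_∘_)
  open import Relation.Nullary using (¬_; contradiction)
  open import Relation.Binary.PropositionalEquality

  ∑< : ℕ → (ℕ → ℕ) → ℕ
  ∑< zero    f = 0
  ∑< (suc n) f = f 0 + ∑< n (f ∘ suc)

  syntax ∑< n (λ i → e) = ∑[ i < n ] e

  indicator : Bool → ℕ
  indicator true  = 1
  indicator false = 0

  indicator-¬T : ∀ {b} → ¬ T b → indicator b ≡ 0
  indicator-¬T {true}  ¬Tb = contradiction _ ¬Tb
  indicator-¬T {false} _   = refl

  indicator-T : ∀ {b} → T b → indicator b ≡ 1
  indicator-T {true} _ = refl

  indicator-∧-cong : ∀ p {q r} → (T p → q ≡ r) → indicator (p ∧ q) ≡ indicator (p ∧ r)
  indicator-∧-cong true  q≡r = cong indicator (q≡r _)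
  indicator-∧-cong false _   = refl

  length-filterᵇ-applyUpTo : ∀ (p : ℕ → Bool) f n →
                             length (filterᵇ p (applyUpTo f n)) ≡ ∑[ i < n ] indicator (p (f i))
  length-filterᵇ-applyUpTo p f zero = refl
  length-filterᵇ-applyUpTo p f (suc n) with p (f 0)
  ... | true  = cong suc (length-filterᵇ-applyUpTo p (f ∘ suc) n)
  ... | false = length-filterᵇ-applyUpTo p (f ∘ suc) n

  ∑-cong : ∀ {f g} n → (∀ i → i < n → f i ≡ g i) → ∑< n f ≡ ∑< n g
  ∑-cong zero    f≗g = refl
  ∑-cong (suc n) f≗g = cong₂ _+_ (f≗g 0 z<s) (∑-cong n (λ i i<n → f≗g (suc i) (s<s i<n)))

  ∑-zero : ∀ {f} n → (∀ i → i < n → f i ≡ 0) → ∑< n f ≡ 0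
  ∑-zero n f≗0 = trans (∑-cong n f≗0) (∑-const-zero n)
    where
    ∑-const-zero : ∀ n → ∑[ _ < n ] 0 ≡ 0
    ∑-const-zero zero    = refl
    ∑-const-zero (suc n) = ∑-const-zero n

  ∑-const : ∀ k n → ∑[ _ < n ] k ≡ n * k
  ∑-const k zero    = refl
  ∑-const k (suc n) = cong (k +_) (∑-const k n)

  ∑-split : ∀ f a b → ∑< (a + b) f ≡ ∑< a f + ∑[ i < b ] f (a + i)
  ∑-split f zero    b = refl
  ∑-split f (suc a) b = trans (cong (f 0 +_) (∑-split (f ∘ suc) a b)) (sym (ℕP.+-assoc (f 0) _ _))

  ∑-blocks : ∀ f y z → ∑< (y * z) f ≡ ∑[ j < y ] ∑[ b < z ] f (j * z + b)
  ∑-blocks f zero    z = refl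
  ∑-blocks f (suc y) z = trans (∑-split f z (y * z)) (cong (∑< z f +_) (trans (∑-blocks (λ i → f (z + i)) y z)
    (∑-cong y (λ j _ → ∑-cong z (λ b _ → cong f (sym (ℕP.+-assoc z (j * z) b)))))))

  ∑-distrib-+ : ∀ f g n → ∑[ i < n ] (f i + g i) ≡ ∑< n f + ∑< n g
  ∑-distrib-+ f g zero    = refl
  ∑-distrib-+ f g (suc n) = trans (cong ((f 0 + g 0) +_) (∑-distrib-+ (f ∘ suc) (g ∘ suc) n))
                                  (interchange (f 0) (g 0) (∑< n (f ∘ suc)) (∑< n (g ∘ suc)))

  ∑-comm : ∀ (h : ℕ → ℕ → ℕ) m n → ∑[ i < m ] ∑[ j < n ] h i j ≡ ∑[ j < n ] ∑[ i < m ] h i j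
  ∑-comm h m zero    = ∑-zero m (λ _ _ → refl)
  ∑-comm h m (suc n) = trans (∑-distrib-+ (λ i → h i 0) (λ i → ∑[ j < n ] h i (suc j)) m)
                             (cong (∑[ i < m ] h i 0 +_) (∑-comm (λ i j → h i (suc j)) m n))

  ∑-indicator-unique : ∀ (g : ℕ → Bool) n {j} → j < n → T (g j) →
                       (∀ i → i < n → T (g i) → i ≡ j) → ∑[ i < n ] indicator (g i) ≡ 1
  ∑-indicator-unique g (suc n) {zero} _ g0 unique =
    cong₂ _+_ (indicator-T g0) (∑-zero n (λ i i<n → indicator-¬T (λ gi → ℕP.1+n≢0 (unique (suc i) (s<s i<n) gi))))
  ∑-indicator-unique g (suc n) {suc j} (s<s j<n) gj unique =
    cong₂ _+_ (indicator-¬T (λ g0 → ℕP.0≢1+n (unique 0 z<s g0)))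
              (∑-indicator-unique (g ∘ suc) n j<n gj (λ i i<n gi → ℕP.suc-injective (unique (suc i) (s<s i<n) gi)))

  ∑-around-middle : ∀ (g : ℕ → ℕ) t {A B C} → (∀ j → j < t → g j ≡ A) → g t ≡ B →
                    (∀ i → i < t → g (t + suc i) ≡ C) → ∑< (t + suc t) g ≡ t * A + (B + t * C)
  ∑-around-middle g t {A} {B} {C} below middle above = begin
    ∑< (t + suc t) g                                          ≡⟨ ∑-split g t (suc t) ⟩
    ∑< t g + (g (t + 0) + ∑[ i < t ] g (t + suc i))           ≡⟨ cong₂ _+_ (∑-cong t below)
                                                                   (cong₂ _+_ (trans (cong g (ℕP.+-identityʳ t)) middle) (∑-cong t above)) ⟩
    ∑[ _ < t ] A + (B + ∑[ _ < t ] C)                         ≡⟨ cong₂ (λ u v → u + (B + v)) (∑-const A t) (∑-const C t) ⟩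
    t * A + (B + t * C)                                       ∎
    where open ≡-Reasoning

module Halves where

  open import Data.Nat using (suc; _+_; _*_; _<_; s≤s)
  import Data.Nat.Properties as ℕP
  open import Data.Nat.Tactic.RingSolver using (solve-∀)
  open import Data.Product using (_,_)
  open import Function using (_⇔_; mk⇔)
  open import Relation.Binary.PropositionalEquality

  below-middle-block : ∀ t j z b → j < t → b < z → 2 * (j * z + b) < (t + suc t) * z
  below-middle-block t j z b j<t b<z with ℕP.m≤n⇒∃[o]m+o≡n j<t | ℕP.m≤n⇒∃[o]m+o≡n b<z
  ... | u , refl | v , refl = subst (2 * (j * (suc b + v) + b) <_) (sym (ring j u b v)) (s≤s (ℕP.m≤m+n _ _))
    where ring : ∀ j u b v → (suc j + u + suc (suc j + u)) * (suc b + v)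
                           ≡ suc (2 * (j * (suc b + v) + b) + (2 + b + 3 * v + 2 * u * (suc b + v)))
          ring = solve-∀

  above-middle-block : ∀ t j z b → t < j → 0 < z → (t + suc t) * z < 2 * (j * z + b)
  above-middle-block t j (suc z) b t<j _ with ℕP.m≤n⇒∃[o]m+o≡n t<j
  ... | u , refl = subst ((t + suc t) * suc z <_) (sym (ring t u z b)) (s≤s (ℕP.m≤m+n _ _))
    where ring : ∀ t u z b → 2 * ((suc t + u) * suc z + b)
                           ≡ suc ((t + suc t) * suc z + (z + 2 * u * suc z + 2 * b))
          ring = solve-∀

  private
    double-middle : ∀ t z b → 2 * (t * z + b) ≡ 2 * (t * z) + 2 * b
    double-middle = solve-∀

    block-size : ∀ t z → (t + suc t) * z ≡ 2 * (t * z) + z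
    block-size = solve-∀

  middle-block-low : ∀ t z b → 2 * (t * z + b) < (t + suc t) * z ⇔ 2 * b < z
  middle-block-low t z b = mk⇔
    (λ lt → ℕP.+-cancelˡ-< (2 * (t * z)) (2 * b) z (subst₂ _<_ (double-middle t z b) (block-size t z) lt))
    (λ lt → subst₂ _<_ (sym (double-middle t z b)) (sym (block-size t z)) (ℕP.+-monoʳ-< (2 * (t * z)) lt))

  middle-block-high : ∀ t z b → (t + suc t) * z < 2 * (t * z + b) ⇔ z < 2 * b
  middle-block-high t z b = mk⇔
    (λ lt → ℕP.+-cancelˡ-< (2 * (t * z)) z (2 * b) (subst₂ _<_ (block-size t z) (double-middle t z b) lt))
    (λ lt → subst₂ _<_ (sym (block-size t z)) (sym (double-middle t z b)) (ℕP.+-monoʳ-< (2 * (t * z)) lt))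

module Cosets where

  open import Defs
  open Congruence
  open import Data.Nat as ℕ using (ℕ; zero; suc; NonZero; _<_; _≤_)
  import Data.Nat.Properties as ℕP
  open import Data.Nat.DivMod using (_%_; _/_; m≡m%n+[m/n]*n; m%n<n)
  open import Data.Integer using (ℤ; +_; _*_; 1ℤ; _^_)
  import Data.Integer.Properties as ℤP
  open import Data.Bool using (T)
  open import Data.List using (upTo)
  open import Data.List.Relation.Unary.Any.Properties using (any⁺; any⁻; applyUpTo⁺; applyUpTo⁻)
  open import Data.Fin using (Fin; toℕ; fromℕ<)
  open import Data.Fin.Properties using (pigeonhole; toℕ-fromℕ<; toℕ≤pred[n])
  open import Data.Product using (∃-syntax; _,_; _×_)
  open import Function using (id)
  open import Relation.Binary.PropositionalEquality

  pos-^ : ∀ x k → + (x ℕ.^ k) ≡ (+ x) ^ k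
  pos-^ x zero    = refl
  pos-^ x (suc k) = trans (ℤP.pos-* x (x ℕ.^ k)) (cong (+ x *_) (pos-^ x k))

  InCoset : ℕ → ℕ → ℤ → ℤ → Set
  InCoset x m a b = ∃[ k ] b ≈[ m ] a * (+ x) ^ k

  private
    residue-of-power : ∀ x m .{{_ : NonZero m}} → Fin (suc m) → Fin m
    residue-of-power x m i = fromℕ< (m%n<n (x ℕ.^ toℕ i) m)

  -- Pigeonhole on x^0, …, x^m; the bound p ≤ m is what the bounded search of inCosetᵇ needs.
  power-period : ∀ x m .{{_ : NonZero m}} → Invertible (+ x) m →
                 ∃[ p ] 0 < p × p ≤ m × (+ x) ^ p ≈[ m ] 1ℤ
  power-period x m@(suc _) x-inv with pigeonhole (ℕP.n<1+n m) (residue-of-power x m)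
  ... | i , j , i<j , same-residue =
    p , ℕP.m<n⇒0<n∸m i<j , ℕP.≤-trans (ℕP.m∸n≤m (toℕ j) (toℕ i)) (toℕ≤pred[n] j) , x^p≈1
    where
    p = toℕ j ℕ.∸ toℕ i
    x^i≈x^j : (+ x) ^ toℕ i ≈[ m ] (+ x) ^ toℕ j
    x^i≈x^j = subst₂ (λ u v → u ≈[ m ] v) (pos-^ x (toℕ i)) (pos-^ x (toℕ j))
      (%≡⇒≈ m _ _ (begin
        x ℕ.^ toℕ i % m   ≡⟨ toℕ-fromℕ< (m%n<n (x ℕ.^ toℕ i) m) ⟨
        toℕ (residue-of-power x m i)≡⟨ cong toℕ same-residue ⟩
        toℕ (residue-of-power x m j)≡⟨ toℕ-fromℕ< (m%n<n (x ℕ.^ toℕ j) m) ⟩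
        x ℕ.^ toℕ j % m   ∎))
      where open ≡-Reasoning
    x^p≈1 : (+ x) ^ p ≈[ m ] 1ℤ
    x^p≈1 = ≈-sym (*-cancelˡ-≈ (^-invertible (toℕ i) x-inv) (begin
      (+ x) ^ toℕ i * 1ℤ             ≡⟨ ℤP.*-identityʳ _ ⟩
      (+ x) ^ toℕ i                  ≈⟨ x^i≈x^j ⟩
      (+ x) ^ toℕ j                  ≡⟨ cong ((+ x) ^_) (ℕP.m+[n∸m]≡n (ℕP.<⇒≤ i<j)) ⟨
      (+ x) ^ (toℕ i ℕ.+ p)          ≡⟨ ℤP.^-distribˡ-+-* (+ x) (toℕ i) p ⟩
      (+ x) ^ toℕ i * (+ x) ^ p      ∎))
      where open ≈-Reasoning m

  ^-reduce-exponent : ∀ {m} x p .{{_ : NonZero p}} → (+ x) ^ p ≈[ m ] 1ℤ → ∀ k → (+ x) ^ k ≈[ m ] (+ x) ^ (k % p)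
  ^-reduce-exponent {m} x p x^p≈1 k = begin
    (+ x) ^ k                                 ≡⟨ cong ((+ x) ^_) (m≡m%n+[m/n]*n k p) ⟩
    (+ x) ^ (k % p ℕ.+ k / p ℕ.* p)           ≡⟨ ℤP.^-distribˡ-+-* (+ x) (k % p) (k / p ℕ.* p) ⟩
    (+ x) ^ (k % p) * (+ x) ^ (k / p ℕ.* p)   ≡⟨ cong (λ e → (+ x) ^ (k % p) * (+ x) ^ e) (ℕP.*-comm (k / p) p) ⟩
    (+ x) ^ (k % p) * (+ x) ^ (p ℕ.* (k / p)) ≡⟨ cong ((+ x) ^ (k % p) *_) (ℤP.^-*-assoc (+ x) p (k / p)) ⟨
    (+ x) ^ (k % p) * ((+ x) ^ p) ^ (k / p)   ≈⟨ *-congˡ ((+ x) ^ (k % p)) (^-cong (k / p) x^p≈1) ⟩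
    (+ x) ^ (k % p) * 1ℤ ^ (k / p)            ≡⟨ cong ((+ x) ^ (k % p) *_) (ℤP.^-zeroˡ (k / p)) ⟩
    (+ x) ^ (k % p) * 1ℤ                      ≡⟨ ℤP.*-identityʳ _ ⟩
    (+ x) ^ (k % p)                           ∎
    where open ≈-Reasoning m

  private
    pos-*^ : ∀ a x k → + (a ℕ.* x ℕ.^ k) ≡ + a * (+ x) ^ k
    pos-*^ a x k = trans (ℤP.pos-* a (x ℕ.^ k)) (cong (+ a *_) (pos-^ x k))

    modEqᵇ⇒≈ : ∀ m b c .{{_ : NonZero m}} → T (modEqᵇ m b c) → + b ≈[ m ] + c
    modEqᵇ⇒≈ (suc m) b c eq = %≡⇒≈ (suc m) b c (ℕP.≡ᵇ⇒≡ _ _ eq)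

    ≈⇒modEqᵇ : ∀ m b c .{{_ : NonZero m}} → + b ≈[ m ] + c → T (modEqᵇ m b c)
    ≈⇒modEqᵇ (suc m) b c b≈c = ℕP.≡⇒≡ᵇ _ _ (≈⇒%≡ (suc m) b c b≈c)

  inCosetᵇ⇒InCoset : ∀ x m a b .{{_ : NonZero m}} → T (inCosetᵇ x m a b) → InCoset x m (+ a) (+ b)
  inCosetᵇ⇒InCoset x m a b mem with applyUpTo⁻ id (any⁻ _ (upTo m) mem)
  ... | k , _ , b≡ax^k = k , subst (λ v → + b ≈[ m ] v) (pos-*^ a x k) (modEqᵇ⇒≈ m b _ b≡ax^k)

  InCoset⇒inCosetᵇ : ∀ x m a b .{{_ : NonZero m}} → Invertible (+ x) m → InCoset x m (+ a) (+ b) → T (inCosetᵇ x m a b)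
  InCoset⇒inCosetᵇ x m a b x-inv (k , b≈ax^k) with power-period x m x-inv
  ... | p@(suc _) , _ , p≤m , x^p≈1 =
    any⁺ _ (applyUpTo⁺ id (≈⇒modEqᵇ m b (a ℕ.* x ℕ.^ r) b≈ax^r) (ℕP.<-≤-trans (m%n<n k p) p≤m))
    where
    r : ℕ
    r = k % p
    b≈ax^r : + b ≈[ m ] + (a ℕ.* x ℕ.^ r)
    b≈ax^r = subst (λ v → + b ≈[ m ] v) (sym (pos-*^ a x r))
                   (≈-trans b≈ax^k (*-congˡ (+ a) (^-reduce-exponent x p x^p≈1 k)))

module HalfCounts where

  open import Defs
  open Sums
  open import Data.Nat using (ℕ; _*_; _<_; _<ᵇ_)
  import Data.Nat.Properties as ℕP
  open import Data.Bool using (Bool; true; false; T; _∧_)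
  open import Function using (id; _⇔_; Equivalence)
  open import Relation.Nullary using (¬_; contradiction)
  open import Relation.Binary.PropositionalEquality

  low high : ℕ → ℕ → Bool
  low  m c = (0 <ᵇ c) ∧ (2 * c <ᵇ m)
  high m c = m <ᵇ 2 * c

  lowCount≡∑ : ∀ n m a → lowCount n m a ≡ ∑[ c < m ] indicator (inCosetᵇ n m a c ∧ low m c)
  lowCount≡∑ n m a = length-filterᵇ-applyUpTo _ id m

  highCount≡∑ : ∀ n m a → highCount n m a ≡ ∑[ c < m ] indicator (inCosetᵇ n m a c ∧ high m c)
  highCount≡∑ n m a = length-filterᵇ-applyUpTo _ id m

  T-ext : ∀ {b c} → (T b → T c) → (T c → T b) → b ≡ c
  T-ext {true}  {true}  _ _ = refl
  T-ext {true}  {false} f _ = contradiction (f _) id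
  T-ext {false} {true}  _ g = contradiction (g _) id
  T-ext {false} {false} _ _ = refl

  <ᵇ-true : ∀ {m n} → m < n → (m <ᵇ n) ≡ true
  <ᵇ-true m<n = T-ext (λ _ → _) (λ _ → ℕP.<⇒<ᵇ m<n)

  <ᵇ-false : ∀ {m n} → ¬ m < n → (m <ᵇ n) ≡ false
  <ᵇ-false {m} {n} m≮n = T-ext (λ m<ᵇn → contradiction (ℕP.<ᵇ⇒< m n m<ᵇn) m≮n) (λ ())

  <ᵇ-cong : ∀ {m n m′ n′} → (m < n ⇔ m′ < n′) → (m <ᵇ n) ≡ (m′ <ᵇ n′)
  <ᵇ-cong {m} {n} {m′} {n′} m<n⇔m′<n′ =
    T-ext (λ lt → ℕP.<⇒<ᵇ (Equivalence.to   m<n⇔m′<n′ (ℕP.<ᵇ⇒< m n lt)))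
          (λ lt → ℕP.<⇒<ᵇ (Equivalence.from m<n⇔m′<n′ (ℕP.<ᵇ⇒< m′ n′ lt)))

module Lifting (y z : ℕ) (y∣z : y ∣ z) .{{_ : NonZero y}} where

  open Congruence
  open import Data.Nat as ℕ using (ℕ; zero; suc; NonZero; _<_)
  import Data.Nat.Properties as ℕP
  open import Data.Nat.Divisibility using (n∣m*n; *-monoˡ-∣)
  open import Data.Integer using (ℤ; +_; _+_; _*_; -_; _-_; 1ℤ; 0ℤ; _^_; _%ℕ_)
  import Data.Integer.Properties as ℤP
  open import Data.Integer.DivMod using (n%ℕd<d)
  open import Data.Integer.Tactic.RingSolver using (solve-∀)
  open import Data.Product using (∃-syntax; _,_; _×_)
  open import Relation.Binary.PropositionalEquality

  M : ℕ
  M = y ℕ.* z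

  Z : ℤ
  Z = + z

  z∣M : z ∣ M
  z∣M = n∣m*n y

  Z²≈0 : Z * Z ≈[ M ] 0ℤ
  Z²≈0 = ≈-∣ (*-monoˡ-∣ z y∣z) (1ℤ , (begin
    Z * Z                     ≡⟨ ℤP.pos-* z z ⟨
    + (z ℕ.* z)               ≡⟨ ring (+ (z ℕ.* z)) ⟩
    0ℤ + 1ℤ * + (z ℕ.* z)     ∎))
    where
    open ≡-Reasoning
    ring : ∀ a → a ≡ 0ℤ + 1ℤ * a
    ring = solve-∀

  Z²-negligible : ∀ a c → a + c * (Z * Z) ≈[ M ] a
  Z²-negligible a c = begin
    a + c * (Z * Z)   ≈⟨ +-cong (≈-refl {a = a}) (*-congˡ c Z²≈0) ⟩
    a + c * 0ℤ        ≡⟨ cong (_+_ a) (ℤP.*-zeroʳ c) ⟩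
    a + 0ℤ            ≡⟨ ℤP.+-identityʳ a ⟩
    a                 ∎
    where open ≈-Reasoning M

  *Z-cong : ∀ {a b} → a ≈[ y ] b → a * Z ≈[ M ] b * Z
  *Z-cong {b = b} (q , refl) = q , (begin
    (b + q * + y) * Z      ≡⟨ ring b q (+ y) Z ⟩
    b * Z + q * (+ y * Z)  ≡⟨ cong (λ v → b * Z + q * v) (ℤP.pos-* y z) ⟨
    b * Z + q * + M        ∎)
    where
    open ≡-Reasoning
    ring : ∀ b q y z → (b + q * y) * z ≡ b * z + q * (y * z)
    ring = solve-∀

  invertible-lift : ∀ {u} → Invertible u z → Invertible u M
  invertible-lift u-inv = invertible-∣ (*-monoˡ-∣ z y∣z) (invertible-square u-inv)

  invertible-reduce : ∀ {u} → Invertible u z → Invertible u y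
  invertible-reduce = invertible-∣ y∣z

  1-JZ*1+JZ≈1 : ∀ J → (1ℤ - J * Z) * (1ℤ + J * Z) ≈[ M ] 1ℤ
  1-JZ*1+JZ≈1 J = begin
    (1ℤ - J * Z) * (1ℤ + J * Z)      ≡⟨ ring J Z ⟩
    1ℤ + - (J * J) * (Z * Z)         ≈⟨ Z²-negligible 1ℤ (- (J * J)) ⟩
    1ℤ                               ∎
    where
    open ≈-Reasoning M
    ring : ∀ J Z → (1ℤ - J * Z) * (1ℤ + J * Z) ≡ 1ℤ + - (J * J) * (Z * Z)
    ring = solve-∀

  1+JZ-invertible : ∀ J → Invertible (1ℤ + J * Z) M
  1+JZ-invertible J = 1ℤ - J * Z , 1-JZ*1+JZ≈1 J

  [1+DZ]^r≈1+rDZ : ∀ D r → (1ℤ + D * Z) ^ r ≈[ M ] 1ℤ + + r * D * Z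
  [1+DZ]^r≈1+rDZ D zero = ≡⇒≈ (ring D Z)
    where ring : ∀ D Z → 1ℤ ≡ 1ℤ + 0ℤ * D * Z
          ring = solve-∀
  [1+DZ]^r≈1+rDZ D (suc r) = begin
    (1ℤ + D * Z) * (1ℤ + D * Z) ^ r                   ≈⟨ *-congˡ (1ℤ + D * Z) ([1+DZ]^r≈1+rDZ D r) ⟩
    (1ℤ + D * Z) * (1ℤ + + r * D * Z)                 ≡⟨ ring D Z (+ r) ⟩
    1ℤ + (1ℤ + + r) * D * Z + + r * D * D * (Z * Z)   ≈⟨ Z²-negligible _ (+ r * D * D) ⟩
    1ℤ + (1ℤ + + r) * D * Z                           ∎
    where
    open ≈-Reasoning M
    ring : ∀ D Z r → (1ℤ + D * Z) * (1ℤ + r * D * Z) ≡ 1ℤ + (1ℤ + r) * D * Z + r * D * D * (Z * Z)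
    ring = solve-∀

  reduce-1+JZ : ∀ {c} A J P → c ≈[ M ] A * (1ℤ + J * Z) * P → c ≈[ z ] A * P
  reduce-1+JZ {c} A J P c≈ = begin
    c                        ≈⟨ ≈-∣ z∣M c≈ ⟩
    A * (1ℤ + J * Z) * P     ≡⟨ ring A J P Z ⟩
    A * P + A * J * P * Z    ≈⟨ a+km≈a (A * P) (A * J * P) ⟩
    A * P                    ∎
    where
    open ≈-Reasoning z
    ring : ∀ A J P Z → A * (1ℤ + J * Z) * P ≡ A * P + A * J * P * Z
    ring = solve-∀

  lift-1+jZ : ∀ {c} A P → Invertible (A * P) y → c ≈[ z ] A * P →
              ∃[ j ] j < y × c ≈[ M ] A * (1ℤ + + j * Z) * P
  lift-1+jZ A P (s , s*AP≈1) (q , refl) = j , n%ℕd<d (q * s) y , (begin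
    A * P + q * Z              ≈⟨ +-cong (≈-refl {a = A * P}) (*Z-cong (q≈u*[q*s%m] {u = A * P} q s*AP≈1)) ⟩
    A * P + A * P * + j * Z    ≡⟨ ring A P (+ j) Z ⟩
    A * (1ℤ + + j * Z) * P     ∎)
    where
    open ≈-Reasoning M
    j : ℕ
    j = (q * s) %ℕ y
    ring : ∀ A P J Z → A * P + A * P * J * Z ≡ A * (1ℤ + J * Z) * P
    ring = solve-∀

  1+jZ-absorbed : ∀ {X k₀} A j k → 1ℤ + Z ≈[ M ] X ^ k₀ →
                  A * (1ℤ + + j * Z) * X ^ k ≈[ M ] A * X ^ (k₀ ℕ.* j ℕ.+ k)
  1+jZ-absorbed {X} {k₀} A j k 1+Z≈X^k₀ = begin
    A * (1ℤ + + j * Z) * X ^ k        ≈⟨ *-congʳ (X ^ k) (*-congˡ A 1+jZ≈X^k₀j) ⟩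
    A * X ^ (k₀ ℕ.* j) * X ^ k        ≡⟨ ℤP.*-assoc A _ _ ⟩
    A * (X ^ (k₀ ℕ.* j) * X ^ k)      ≡⟨ cong (A *_) (ℤP.^-distribˡ-+-* X (k₀ ℕ.* j) k) ⟨
    A * X ^ (k₀ ℕ.* j ℕ.+ k)          ∎
    where
    open ≈-Reasoning M
    ring : ∀ J Z → 1ℤ + J * Z ≡ 1ℤ + J * 1ℤ * Z
    ring = solve-∀
    1+jZ≈X^k₀j : 1ℤ + + j * Z ≈[ M ] X ^ (k₀ ℕ.* j)
    1+jZ≈X^k₀j = begin
      1ℤ + + j * Z          ≡⟨ ring (+ j) Z ⟩
      1ℤ + + j * 1ℤ * Z     ≈⟨ [1+DZ]^r≈1+rDZ 1ℤ j ⟨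
      (1ℤ + 1ℤ * Z) ^ j     ≡⟨ cong (λ v → (1ℤ + v) ^ j) (ℤP.*-identityˡ Z) ⟩
      (1ℤ + Z) ^ j          ≈⟨ ^-cong j 1+Z≈X^k₀ ⟩
      (X ^ k₀) ^ j          ≡⟨ ℤP.^-*-assoc X k₀ j ⟩
      X ^ (k₀ ℕ.* j)        ∎

  1+NZ^ρ≈1+Z : ∀ N ρ → + ρ * N ≈[ y ] 1ℤ → (1ℤ + N * Z) ^ ρ ≈[ M ] 1ℤ + Z
  1+NZ^ρ≈1+Z N ρ ρN≈1 = begin
    (1ℤ + N * Z) ^ ρ   ≈⟨ [1+DZ]^r≈1+rDZ N ρ ⟩
    1ℤ + + ρ * N * Z   ≈⟨ +-cong (≈-refl {a = 1ℤ}) (*Z-cong ρN≈1) ⟩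
    1ℤ + 1ℤ * Z        ≡⟨ cong (_+_ 1ℤ) (ℤP.*-identityˡ Z) ⟩
    1ℤ + Z             ∎
    where open ≈-Reasoning M

  1+jZ-quotient : ∀ {P P′} j j′ → j′ ℕ.≤ j → (1ℤ + + j * Z) * P ≈[ M ] (1ℤ + + j′ * Z) * P′ →
                  (1ℤ + + (j ℕ.∸ j′) * Z) * P ≈[ M ] P′
  1+jZ-quotient {P} {P′} j j′ j′≤j eq = begin
    (1ℤ + N * Z) * P                        ≈⟨ *-congʳ P 1-J′Z*1+jZ≈1+NZ ⟨
    (1ℤ - J′ * Z) * (1ℤ + + j * Z) * P      ≡⟨ ℤP.*-assoc (1ℤ - J′ * Z) (1ℤ + + j * Z) P ⟩
    (1ℤ - J′ * Z) * ((1ℤ + + j * Z) * P)    ≈⟨ *-congˡ (1ℤ - J′ * Z) eq ⟩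
    (1ℤ - J′ * Z) * ((1ℤ + J′ * Z) * P′)    ≡⟨ ℤP.*-assoc (1ℤ - J′ * Z) (1ℤ + J′ * Z) P′ ⟨
    (1ℤ - J′ * Z) * (1ℤ + J′ * Z) * P′      ≈⟨ *-congʳ P′ (1-JZ*1+JZ≈1 J′) ⟩
    1ℤ * P′                                 ≡⟨ ℤP.*-identityˡ P′ ⟩
    P′                                      ∎
    where
    open ≈-Reasoning M
    N J′ : ℤ
    N  = + (j ℕ.∸ j′)
    J′ = + j′
    ring : ∀ J′ N Z → (1ℤ - J′ * Z) * (1ℤ + (J′ + N) * Z) ≡ 1ℤ + N * Z + - (J′ * (J′ + N)) * (Z * Z)
    ring = solve-∀
    1-J′Z*1+jZ≈1+NZ : (1ℤ - J′ * Z) * (1ℤ + + j * Z) ≈[ M ] 1ℤ + N * Z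
    1-J′Z*1+jZ≈1+NZ = begin
      (1ℤ - J′ * Z) * (1ℤ + + j * Z)             ≡⟨ cong (λ v → (1ℤ - J′ * Z) * (1ℤ + + v * Z)) (ℕP.m+[n∸m]≡n j′≤j) ⟨
      (1ℤ - J′ * Z) * (1ℤ + + (j′ ℕ.+ (j ℕ.∸ j′)) * Z) ≡⟨ cong (λ v → (1ℤ - J′ * Z) * (1ℤ + v * Z)) (ℤP.pos-+ j′ (j ℕ.∸ j′)) ⟩
      (1ℤ - J′ * Z) * (1ℤ + (J′ + N) * Z)        ≡⟨ ring J′ N Z ⟩
      1ℤ + N * Z + - (J′ * (J′ + N)) * (Z * Z)   ≈⟨ Z²-negligible (1ℤ + N * Z) (- (J′ * (J′ + N))) ⟩
      1ℤ + N * Z                                 ∎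

  -- If two of the cosets a(1 + jz)⟨x⟩ meet, their quotient 1 + (j − j′)z lies in ⟨x⟩, and as
  -- j − j′ is a unit mod y, a power of it is 1 + z.
  coset-collision : ∀ {A X} j j′ k k′ p → j′ < j → Invertible A M → X ^ suc p ≈[ M ] 1ℤ →
                    Invertible (+ (j ℕ.∸ j′)) y →
                    A * (1ℤ + + j * Z) * X ^ k ≈[ M ] A * (1ℤ + + j′ * Z) * X ^ k′ →
                    ∃[ E ] X ^ E ≈[ M ] 1ℤ + Z
  coset-collision {A} {X} j j′ k k′ p j′<j A-inv X^[1+p]≈1 (r , rN≈1) collision = e ℕ.* ρ , (begin
    X ^ (e ℕ.* ρ)      ≡⟨ ℤP.^-*-assoc X e ρ ⟨
    (X ^ e) ^ ρ        ≈⟨ ^-cong ρ 1+NZ≈X^e ⟨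
    (1ℤ + N * Z) ^ ρ   ≈⟨ 1+NZ^ρ≈1+Z N ρ ρN≈1 ⟩
    1ℤ + Z             ∎)
    where
    open ≈-Reasoning M
    N : ℤ
    N = + (j ℕ.∸ j′)
    e ρ pk : ℕ
    e  = k′ ℕ.+ pk
    ρ  = r %ℕ y
    pk = p ℕ.* k
    ρN≈1 : + ρ * N ≈[ y ] 1ℤ
    ρN≈1 = ≈-trans (*-congʳ N (≈-sym (a≈a%ℕm r y))) rN≈1
    cancelled : (1ℤ + + j * Z) * X ^ k ≈[ M ] (1ℤ + + j′ * Z) * X ^ k′
    cancelled = *-cancelˡ-≈ A-inv (begin
      A * ((1ℤ + + j * Z) * X ^ k)     ≡⟨ ℤP.*-assoc A _ _ ⟨
      A * (1ℤ + + j * Z) * X ^ k       ≈⟨ collision ⟩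
      A * (1ℤ + + j′ * Z) * X ^ k′     ≡⟨ ℤP.*-assoc A _ _ ⟩
      A * ((1ℤ + + j′ * Z) * X ^ k′)   ∎)
    1+NZ≈X^e : 1ℤ + N * Z ≈[ M ] X ^ e
    1+NZ≈X^e = begin
      1ℤ + N * Z                        ≡⟨ ℤP.*-identityʳ (1ℤ + N * Z) ⟨
      (1ℤ + N * Z) * 1ℤ                 ≈⟨ *-congˡ (1ℤ + N * Z) (x^k*x^pk≈1 {p = p} k X^[1+p]≈1) ⟨
      (1ℤ + N * Z) * (X ^ k * X ^ pk)   ≡⟨ ℤP.*-assoc (1ℤ + N * Z) (X ^ k) (X ^ pk) ⟨
      (1ℤ + N * Z) * X ^ k * X ^ pk     ≈⟨ *-congʳ (X ^ pk) (1+jZ-quotient j j′ (ℕP.<⇒≤ j′<j) cancelled) ⟩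
      X ^ k′ * X ^ pk                   ≡⟨ ℤP.^-distribˡ-+-* X k′ pk ⟨
      X ^ e                             ∎

module Balance (x y z t a : ℕ) (y-prime : Prime y) (y∣z : y ∣ z) (y≡t+1+t : y ≡ t ℕ.+ ℕ.suc t)
               (x⊥z : Coprime x z) (a⊥z : Coprime a z) .{{_ : NonZero z}} where

  open import Defs
  open Congruence
  open Sums
  open Halves
  open Cosets
  open HalfCounts
  open import Data.Nat as ℕ using (ℕ; zero; suc; NonZero; _+_; _*_; _<_; _≤_; z<s; _<ᵇ_)
  import Data.Nat.Properties as ℕP
  open import Data.Nat.Divisibility using (∣⇒≤)
  open import Data.Nat.Primality using (prime⇒nonZero; prime⇒nonTrivial)
  open import Data.Nat.Coprimality using (prime⇒coprime)
  import Data.Nat.Coprimality as Coprimality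
  open import Data.Integer as ℤ using (ℤ; +_; 1ℤ; _^_) renaming (_*_ to _*ℤ_; _+_ to _+ℤ_)
  import Data.Integer.Properties as ℤP
  open import Data.Bool using (Bool; true; false; T; _∧_)
  open import Data.Bool.Properties using (∧-identityʳ; ∧-zeroʳ; T?)
  open import Data.Product using (∃-syntax; _,_; _×_; proj₁; proj₂)
  open import Function using (_⇔_)
  open import Relation.Nullary using (¬_; Dec; contradiction; yes; no)
  open import Relation.Binary.Definitions using (Tri; tri<; tri≈; tri>)
  open import Relation.Binary.PropositionalEquality

  instance
    y≢0 : NonZero y
    y≢0 = prime⇒nonZero y-prime

  open Lifting y z y∣z

  instance
    M≢0 : NonZero M
    M≢0 = ℕP.m*n≢0 y z

  X A : ℤ
  X = + x
  A = + a

  x-inv-z : Invertible X z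
  x-inv-z = coprime⇒invertible x⊥z

  a-inv-z : Invertible A z
  a-inv-z = coprime⇒invertible a⊥z

  inQ : ℕ → Bool
  inQ = inCosetᵇ x z a

  inQ⇒ : ∀ {c} → T (inQ c) → InCoset x z A (+ c)
  inQ⇒ = inCosetᵇ⇒InCoset x z a _

  inQ⇐ : ∀ {c} → InCoset x z A (+ c) → T (inQ c)
  inQ⇐ = InCoset⇒inCosetᵇ x z a _ x-inv-z

  inQ-periodic : ∀ j b → inQ (j * z + b) ≡ inQ b
  inQ-periodic j b = T-ext (λ mem → let k , r = inQ⇒ mem in inQ⇐ (k , ≈-trans (≈-sym shift) r))
                           (λ mem → let k , r = inQ⇒ mem in inQ⇐ (k , ≈-trans shift r))
    where
    shift : + (j * z + b) ≈[ z ] + b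
    shift = + j , trans (ℤP.+-comm (+ (j * z)) (+ b)) (cong (+ b +ℤ_) (ℤP.pos-* j z))

  1<z : 1 < z
  1<z = ℕP.<-≤-trans (ℕ.nonTrivial⇒n>1 y {{prime⇒nonTrivial y-prime}}) (∣⇒≤ y∣z)

  inQ⇒positive : ∀ {c} → T (inQ c) → 0 < c
  inQ⇒positive {zero} mem with inQ⇒ mem
  ... | k , 0≈ax^k = contradiction
    (invertible≈0⇒m≡1 (*-invertible a-inv-z (^-invertible k x-inv-z)) (≈-sym 0≈ax^k)) (ℕP.>⇒≢ 1<z)
  inQ⇒positive {suc c} _ = z<s

  aⱼ : ℕ → ℕ
  aⱼ j = a * (1 + j * z)

  +aⱼ : ∀ j → + aⱼ j ≡ A *ℤ (1ℤ +ℤ + j *ℤ Z)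
  +aⱼ j = trans (ℤP.pos-* a (1 + j * z)) (cong (λ v → A *ℤ (1ℤ +ℤ v)) (ℤP.pos-* j z))

  aⱼ⊥M : ∀ j → Coprime (aⱼ j) M
  aⱼ⊥M j = invertible⇒coprime (subst (λ u → Invertible u M) (sym (+aⱼ j))
                                      (*-invertible (invertible-lift a-inv-z) (1+JZ-invertible (+ j))))

  inQⱼ : ℕ → ℕ → Bool
  inQⱼ j = inCosetᵇ x M (aⱼ j)

  inQⱼ⇒ : ∀ {j c} → T (inQⱼ j c) → ∃[ k ] + c ≈[ M ] A *ℤ (1ℤ +ℤ + j *ℤ Z) *ℤ X ^ k
  inQⱼ⇒ {j} {c} mem with inCosetᵇ⇒InCoset x M (aⱼ j) c mem
  ... | k , c≈ = k , subst (λ v → + c ≈[ M ] v *ℤ X ^ k) (+aⱼ j) c≈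

  inQⱼ⇐ : ∀ {j c k} → + c ≈[ M ] A *ℤ (1ℤ +ℤ + j *ℤ Z) *ℤ X ^ k → T (inQⱼ j c)
  inQⱼ⇐ {j} {c} {k} c≈ = InCoset⇒inCosetᵇ x M (aⱼ j) c (invertible-lift x-inv-z)
                           (k , subst (λ v → + c ≈[ M ] v *ℤ X ^ k) (sym (+aⱼ j)) c≈)

  inQⱼ⇒inQ : ∀ {j c} → T (inQⱼ j c) → T (inQ c)
  inQⱼ⇒inQ {j} mem with inQⱼ⇒ {j} mem
  ... | k , c≈ = inQ⇐ (k , reduce-1+JZ A (+ j) (X ^ k) c≈)

  inQ⇒inQⱼ : ∀ {c} → T (inQ c) → ∃[ j ] j < y × ∃[ k ] + c ≈[ M ] A *ℤ (1ℤ +ℤ + j *ℤ Z) *ℤ X ^ k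
  inQ⇒inQⱼ mem =
    let k , c≈      = inQ⇒ mem
        j , j<y , c≈′ = lift-1+jZ A (X ^ k) (*-invertible (invertible-reduce a-inv-z)
                                                         (^-invertible k (invertible-reduce x-inv-z))) c≈
    in j , j<y , k , c≈′


  1+z∈⟨x⟩ : Bool
  1+z∈⟨x⟩ = inCosetᵇ x M 1 (1 + z)

  inCoset-a≡inQ : T 1+z∈⟨x⟩ → ∀ c → inCosetᵇ x M a c ≡ inQ c
  inCoset-a≡inQ mem c = T-ext
    (λ memM → let k , c≈ = inCosetᵇ⇒InCoset x M a c memM in inQ⇐ (k , ≈-∣ z∣M c≈))
    (λ memQ → let j , _ , k , c≈ = inQ⇒inQⱼ memQ in
      InCoset⇒inCosetᵇ x M a c (invertible-lift x-inv-z)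
        (k₀ * j + k , ≈-trans c≈ (1+jZ-absorbed {k₀ = k₀} A j k 1+Z≈X^k₀)))
    where
    k₀ : ℕ
    k₀ = proj₁ (inCosetᵇ⇒InCoset x M 1 (1 + z) mem)
    1+Z≈X^k₀ : 1ℤ +ℤ Z ≈[ M ] X ^ k₀
    1+Z≈X^k₀ = ≈-trans (proj₂ (inCosetᵇ⇒InCoset x M 1 (1 + z) mem)) (≡⇒≈ (ℤP.*-identityˡ _))

  x-period : ∃[ p ] X ^ suc p ≈[ M ] 1ℤ
  x-period = positive-period (power-period x M (invertible-lift x-inv-z))
    where
    positive-period : (∃[ p ] 0 < p × p ≤ M × X ^ p ≈[ M ] 1ℤ) → ∃[ p ] X ^ suc p ≈[ M ] 1ℤ
    positive-period (suc p , _ , _ , X^[1+p]≈1) = p , X^[1+p]≈1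

  inQⱼ-disjoint : ¬ T 1+z∈⟨x⟩ → ∀ {c j j′} → j′ < j → j < y → T (inQⱼ j c) → ¬ T (inQⱼ j′ c)
  inQⱼ-disjoint 1+z∉⟨x⟩ {c} {j} {j′} j′<j j<y mem mem′ =
    1+z∉⟨x⟩ (InCoset⇒inCosetᵇ x M 1 (1 + z) (invertible-lift x-inv-z)
                (E , ≈-trans (≈-sym X^E≈1+Z) (≡⇒≈ (sym (ℤP.*-identityˡ _)))))
    where
    k k′ p : ℕ
    k  = proj₁ (inQⱼ⇒ {j} mem)
    k′ = proj₁ (inQⱼ⇒ {j′} mem′)
    p  = proj₁ x-period
    j-j′-invertible : Invertible (+ (j ℕ.∸ j′)) y
    j-j′-invertible = coprime⇒invertible (Coprimality.sym
      (prime⇒coprime y-prime {{ℕ.>-nonZero (ℕP.m<n⇒0<n∸m j′<j)}} (ℕP.≤-<-trans (ℕP.m∸n≤m j j′) j<y)))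
    collision : ∃[ E ] X ^ E ≈[ M ] 1ℤ +ℤ Z
    collision = coset-collision j j′ k k′ p j′<j (invertible-lift a-inv-z) (proj₂ x-period) j-j′-invertible
                  (≈-trans (≈-sym (proj₂ (inQⱼ⇒ {j} mem))) (proj₂ (inQⱼ⇒ {j′} mem′)))
    E : ℕ
    E = proj₁ collision
    X^E≈1+Z : X ^ E ≈[ M ] 1ℤ +ℤ Z
    X^E≈1+Z = proj₂ collision

  inQⱼ-unique : ¬ T 1+z∈⟨x⟩ → ∀ {c j j′} → j < y → j′ < y → T (inQⱼ j c) → T (inQⱼ j′ c) → j′ ≡ j
  inQⱼ-unique 1+z∉⟨x⟩ {j = j} {j′} j<y j′<y mem mem′ = compare (ℕP.<-cmp j′ j)
    where
    compare : Tri (j′ < j) (j′ ≡ j) (j < j′) → j′ ≡ j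
    compare (tri< j′<j _ _) = contradiction mem′ (inQⱼ-disjoint 1+z∉⟨x⟩ j′<j j<y mem)
    compare (tri≈ _ j′≡j _) = j′≡j
    compare (tri> _ _ j<j′) = contradiction mem (inQⱼ-disjoint 1+z∉⟨x⟩ j<j′ j′<y mem′)

  inQ-split : ¬ T 1+z∈⟨x⟩ → ∀ c → indicator (inQ c) ≡ ∑[ j < y ] indicator (inQⱼ j c)
  inQ-split 1+z∉⟨x⟩ c = by-membership (T? (inQ c))
    where
    by-membership : Dec (T (inQ c)) → indicator (inQ c) ≡ ∑[ j < y ] indicator (inQⱼ j c)
    by-membership (yes mem) = let j , j<y , k , c≈ = inQ⇒inQⱼ mem in
      trans (indicator-T mem) (sym (∑-indicator-unique (λ i → inQⱼ i c) y j<y (inQⱼ⇐ {j} {c} {k} c≈)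
                                     (λ i i<y memᵢ → inQⱼ-unique 1+z∉⟨x⟩ j<y i<y (inQⱼ⇐ {j} {c} {k} c≈) memᵢ)))
    by-membership (no ¬mem) =
      trans (indicator-¬T ¬mem) (sym (∑-zero y (λ j _ → indicator-¬T (λ memⱼ → ¬mem (inQⱼ⇒inQ {j} memⱼ)))))

  inQ∧-split : ¬ T 1+z∈⟨x⟩ → ∀ c L → indicator (inQ c ∧ L) ≡ ∑[ j < y ] indicator (inQⱼ j c ∧ L)
  inQ∧-split 1+z∉⟨x⟩ c true  = begin
    indicator (inQ c ∧ true)                ≡⟨ cong indicator (∧-identityʳ (inQ c)) ⟩
    indicator (inQ c)                       ≡⟨ inQ-split 1+z∉⟨x⟩ c ⟩
    ∑[ j < y ] indicator (inQⱼ j c)         ≡⟨ ∑-cong y (λ j _ → cong indicator (∧-identityʳ (inQⱼ j c))) ⟨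
    ∑[ j < y ] indicator (inQⱼ j c ∧ true)  ∎
    where open ≡-Reasoning
  inQ∧-split 1+z∉⟨x⟩ c false = trans (cong indicator (∧-zeroʳ (inQ c)))
                                      (sym (∑-zero y (λ j _ → cong indicator (∧-zeroʳ (inQⱼ j c)))))

  M≡[t+1+t]*z : M ≡ (t + suc t) * z
  M≡[t+1+t]*z = cong (_* z) y≡t+1+t

  0<jz+b : ∀ j {b} → 0 < b → 0 < j * z + b
  0<jz+b j {b} 0<b = ℕP.<-≤-trans 0<b (ℕP.m≤n+m b (j * z))

  below-middle : ∀ {j b} → j < t → b < z → 2 * (j * z + b) < M
  below-middle {j} {b} j<t b<z = subst (2 * (j * z + b) <_) (sym M≡[t+1+t]*z) (below-middle-block t j z b j<t b<z)

  above-middle : ∀ {j} b → t < j → M < 2 * (j * z + b)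
  above-middle {j} b t<j = subst (_< 2 * (j * z + b)) (sym M≡[t+1+t]*z) (above-middle-block t j z b t<j (ℕ.>-nonZero⁻¹ z))

  low-below : ∀ {j b} → j < t → b < z → T (inQ b) → low M (j * z + b) ≡ true
  low-below {j} j<t b<z mem = cong₂ _∧_ (<ᵇ-true (0<jz+b j (inQ⇒positive mem))) (<ᵇ-true (below-middle j<t b<z))

  low-middle : ∀ {b} → T (inQ b) → low M (t * z + b) ≡ low z b
  low-middle {b} mem = cong₂ _∧_
    (trans (<ᵇ-true (0<jz+b t (inQ⇒positive mem))) (sym (<ᵇ-true (inQ⇒positive mem))))
    (<ᵇ-cong (subst (λ m → 2 * (t * z + b) < m ⇔ 2 * b < z) (sym M≡[t+1+t]*z) (middle-block-low t z b)))

  low-above : ∀ {j} b → t < j → low M (j * z + b) ≡ false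
  low-above {j} b t<j = trans (cong ((0 <ᵇ j * z + b) ∧_) (<ᵇ-false (λ lt → ℕP.<-asym lt (above-middle b t<j))))
                              (∧-zeroʳ _)

  high-below : ∀ {j b} → j < t → b < z → high M (j * z + b) ≡ false
  high-below j<t b<z = <ᵇ-false (λ lt → ℕP.<-asym lt (below-middle j<t b<z))

  high-middle : ∀ b → high M (t * z + b) ≡ high z b
  high-middle b = <ᵇ-cong (subst (λ m → m < 2 * (t * z + b) ⇔ z < 2 * b) (sym M≡[t+1+t]*z) (middle-block-high t z b))

  high-above : ∀ {j} b → t < j → high M (j * z + b) ≡ true
  high-above b t<j = <ᵇ-true (above-middle b t<j)


  Q-count : (ℕ → ℕ → Bool) → ℕ
  Q-count side = ∑[ c < M ] indicator (inQ c ∧ side M c)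

  block : (ℕ → Bool) → ℕ
  block K = ∑[ b < z ] indicator (inQ b ∧ K b)

  block-cong : ∀ {K K′} → (∀ b → b < z → T (inQ b) → K b ≡ K′ b) → block K ≡ block K′
  block-cong K≗K′ = ∑-cong z (λ b b<z → indicator-∧-cong (inQ b) (K≗K′ b b<z))

  N : ℕ
  N = ∑[ b < z ] indicator (inQ b)

  full-block : block (λ _ → true) ≡ N
  full-block = ∑-cong z (λ b _ → cong indicator (∧-identityʳ (inQ b)))

  empty-block : block (λ _ → false) ≡ 0
  empty-block = ∑-zero z (λ b _ → cong indicator (∧-zeroʳ (inQ b)))

  Q-count-blocks : ∀ side → Q-count side ≡ ∑[ j < t + suc t ] block (λ b → side M (j * z + b))
  Q-count-blocks side = begin
    Q-count side
      ≡⟨ ∑-blocks (λ c → indicator (inQ c ∧ side M c)) y z ⟩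
    ∑[ j < y ] ∑[ b < z ] indicator (inQ (j * z + b) ∧ side M (j * z + b))
      ≡⟨ ∑-cong y (λ j _ → ∑-cong z (λ b _ → cong (λ v → indicator (v ∧ side M (j * z + b))) (inQ-periodic j b))) ⟩
    ∑[ j < y ] block (λ b → side M (j * z + b))
      ≡⟨ cong (λ n → ∑[ j < n ] block (λ b → side M (j * z + b))) y≡t+1+t ⟩
    ∑[ j < t + suc t ] block (λ b → side M (j * z + b))
      ∎
    where open ≡-Reasoning

  t<t+1+i : ∀ i → t < t + suc i
  t<t+1+i i = ℕP.m<m+n t z<s

  Q-count-low : Q-count low ≡ t * N + lowCount x z a
  Q-count-low = begin
    Q-count low
      ≡⟨ Q-count-blocks low ⟩
    ∑[ j < t + suc t ] block (λ b → low M (j * z + b))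
      ≡⟨ ∑-around-middle _ t
           (λ j j<t → trans (block-cong (λ _ b<z mem → low-below j<t b<z mem)) full-block)
           (trans (block-cong (λ _ _ → low-middle)) (sym (lowCount≡∑ x z a)))
           (λ i _ → trans (block-cong (λ b _ _ → low-above b (t<t+1+i i))) empty-block) ⟩
    t * N + (lowCount x z a + t * 0)
      ≡⟨ cong (λ v → t * N + (lowCount x z a + v)) (ℕP.*-zeroʳ t) ⟩
    t * N + (lowCount x z a + 0)
      ≡⟨ cong (_+_ (t * N)) (ℕP.+-identityʳ (lowCount x z a)) ⟩
    t * N + lowCount x z a
      ∎
    where open ≡-Reasoning

  Q-count-high : Q-count high ≡ t * N + highCount x z a
  Q-count-high = begin
    Q-count high
      ≡⟨ Q-count-blocks high ⟩
    ∑[ j < t + suc t ] block (λ b → high M (j * z + b))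
      ≡⟨ ∑-around-middle _ t
           (λ j j<t → trans (block-cong (λ _ b<z _ → high-below j<t b<z)) empty-block)
           (trans (block-cong (λ b _ _ → high-middle b)) (sym (highCount≡∑ x z a)))
           (λ i _ → trans (block-cong (λ b _ _ → high-above b (t<t+1+i i))) full-block) ⟩
    t * 0 + (highCount x z a + t * N)
      ≡⟨ cong (_+ (highCount x z a + t * N)) (ℕP.*-zeroʳ t) ⟩
    highCount x z a + t * N
      ≡⟨ ℕP.+-comm (highCount x z a) (t * N) ⟩
    t * N + highCount x z a
      ∎
    where open ≡-Reasoning

  Q-count-balanced : Balanced x M → Q-count low ≡ Q-count high
  Q-count-balanced balanced = by-cases (T? 1+z∈⟨x⟩)
    where
    open ≡-Reasoning
    by-cases : Dec (T 1+z∈⟨x⟩) → Q-count low ≡ Q-count high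
    by-cases (yes 1+z∈) = begin
      Q-count low
        ≡⟨ ∑-cong M (λ c _ → cong (λ v → indicator (v ∧ low M c)) (inCoset-a≡inQ 1+z∈ c)) ⟨
      ∑[ c < M ] indicator (inCosetᵇ x M a c ∧ low M c)
        ≡⟨ lowCount≡∑ x M a ⟨
      lowCount x M a
        ≡⟨ balanced a (invertible⇒coprime (invertible-lift a-inv-z)) ⟩
      highCount x M a
        ≡⟨ highCount≡∑ x M a ⟩
      ∑[ c < M ] indicator (inCosetᵇ x M a c ∧ high M c)
        ≡⟨ ∑-cong M (λ c _ → cong (λ v → indicator (v ∧ high M c)) (inCoset-a≡inQ 1+z∈ c)) ⟩
      Q-count high
        ∎
    by-cases (no 1+z∉) = begin
      Q-count low
        ≡⟨ ∑-cong M (λ c _ → inQ∧-split 1+z∉ c (low M c)) ⟩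
      ∑[ c < M ] ∑[ j < y ] indicator (inQⱼ j c ∧ low M c)
        ≡⟨ ∑-comm (λ c j → indicator (inQⱼ j c ∧ low M c)) M y ⟩
      ∑[ j < y ] ∑[ c < M ] indicator (inQⱼ j c ∧ low M c)
        ≡⟨ ∑-cong y (λ j _ → trans (sym (lowCount≡∑ x M (aⱼ j)))
                             (trans (balanced (aⱼ j) (aⱼ⊥M j)) (highCount≡∑ x M (aⱼ j)))) ⟩
      ∑[ j < y ] ∑[ c < M ] indicator (inQⱼ j c ∧ high M c)
        ≡⟨ ∑-comm (λ c j → indicator (inQⱼ j c ∧ high M c)) M y ⟨
      ∑[ c < M ] ∑[ j < y ] indicator (inQⱼ j c ∧ high M c)
        ≡⟨ ∑-cong M (λ c _ → inQ∧-split 1+z∉ c (high M c)) ⟨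
      Q-count high
        ∎

  balanced⇒coset-balanced : Balanced x M → lowCount x z a ≡ highCount x z a
  balanced⇒coset-balanced balanced = ℕP.+-cancelˡ-≡ (t * N) _ _
    (trans (sym Q-count-low) (trans (Q-count-balanced balanced) Q-count-high))

open import Defs
open import Data.Nat using (ℕ; _*_; _<_)
open import Data.Nat.DivMod using (_%_)
open import Data.Nat.Divisibility using (_∣_)
open import Data.Nat.Primality using (Prime)
open import Data.Nat.Coprimality using (Coprime)
open import Relation.Binary.PropositionalEquality using (_≡_; _≢_)
open import Relation.Nullary using (¬_)

open import Data.Nat using (suc; _+_)
open import Data.Nat.DivMod using (_/_; m≡m%n+[m/n]*n)
open import Data.Nat.Tactic.RingSolver using (solve-∀)
open import Relation.Binary.PropositionalEquality using (trans; cong)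

odd⇒≡t+1+t : ∀ n → n % 2 ≡ 1 → n ≡ n / 2 + suc (n / 2)
odd⇒≡t+1+t n n%2≡1 = trans (m≡m%n+[m/n]*n n 2) (trans (cong (_+ n / 2 * 2) n%2≡1) (ring (n / 2)))
  where ring : ∀ t → 1 + t * 2 ≡ t + suc t
        ring = solve-∀

lemma4p8 : (x y z : ℕ) → Prime x → Prime y → x ≢ y → x % 2 ≡ 1 → y % 2 ≡ 1 →
           z % 2 ≡ 1 → 0 < z → y ∣ z → Coprime x z →
           ¬ Balanced x z → ¬ Balanced x (y * z)
lemma4p8 x y z _ y-prime _ _ y-odd _ 0<z y∣z x⊥z unbalanced balanced =
  unbalanced λ a a⊥z → Balance.balanced⇒coset-balanced x y z (y / 2) a y-prime y∣z (odd⇒≡t+1+t y y-odd)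
                         x⊥z a⊥z {{ℕ.>-nonZero 0<z}} balanced
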